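{- Every safety problem that has an $\mathbf{FBI}$-proof is safe.
   Context: Let $\Sigma$ be a first-order vocabulary and $\Sigma'$ its primed copy; $\varphi'$ denotes $\varphi$ with every symbol primed. A safety problem is a triple $(\iota,\tau,\beta)$ of closed formulas, $\iota,\beta$ over $\Sigma$ and $\tau$ over $\Sigma\cup\Sigma'$. $\tau^{ -1}$ is obtained from $\tau$ by replacing each symbol of $\Sigma$ by its primed counterpart and vice versa. A trace is a finite sequence of $\Sigma$-structures $s_0,\dots,s_k$ over a common domain with each consecutive pair $(s_i,s_{i+1})$ satisfying $\tau$. The problem is safe if no trace has $s_0\models\iota$ and $s_k\models\beta$. $A\Rightarrow B$ denotes validity of $A\to B$. The incremental forward-backward proof system $\mathbf{FBI}$ has rules: (Ind): with no premises, conclude $(\iota,\tau,\neg\varphi)$ provided $\iota\Rightarrow\varphi$ and $\varphi\wedge\tau\Rightarrow\varphi'$; (Cons): from $(\iota,\tau,\neg\varphi)$ conclude $(\iota,\tau,\beta)$ provided $\varphi\Rightarrow\neg\beta$; (Inc): from premises $(\iota,\tau,\neg\varphi)$ and $(\iota\wedge\varphi,\tau\wedge\varphi\wedge\varphi',\beta\wedge\varphi)$ conclude $(\iota,\tau,\beta)$; (Rev): from premise $(\beta,\tau^{ -1},\iota)$ conclude $(\iota,\tau,\beta)$. An $\mathbf{FBI}$-proof of $\Pi$ is a finite tree of safety problems with root $\Pi$, each node the conclusion of a rule applied to its children. -}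

module Defs where

open import Data.Nat using (ℕ; zero; suc; _<_)
open import Data.Fin using (Fin; zero; suc)
open import Data.Vec using (Vec; []; _∷_)
open import Data.Sum using (_⊎_; inj₁; inj₂)
open import Data.Product using (_×_; Σ)
open import Data.Unit using () renaming (⊤ to Unit)
open import Data.Empty using (⊥)
open import Relation.Nullary using (¬_)
open import Relation.Binary.PropositionalEquality using (_≡_)

record Vocabulary : Set₁ where
  field
    Fun : ℕ → Set
    Rel : ℕ → Set
open Vocabulary public

-- Σ ∪ Σ' : inj₁ = unprimed symbol, inj₂ = its primed copy
_² : Vocabulary → Vocabulary
V ² = record { Fun = λ m → Fun V m ⊎ Fun V m ; Rel = λ m → Rel V m ⊎ Rel V m }

record VocMor (V W : Vocabulary) : Set where
  field
    funMap : ∀ {m} → Fun V m → Fun W m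
    relMap : ∀ {m} → Rel V m → Rel W m
open VocMor public

data Term (V : Vocabulary) (n : ℕ) : Set where
  var : Fin n → Term V n
  app : ∀ {m} → Fun V m → Vec (Term V n) m → Term V n

data Formula (V : Vocabulary) (n : ℕ) : Set where
  ⊤ᶠ ⊥ᶠ : Formula V n
  rel   : ∀ {m} → Rel V m → Vec (Term V n) m → Formula V n
  _≐_   : Term V n → Term V n → Formula V n
  ¬ᶠ_   : Formula V n → Formula V n
  _∧ᶠ_ _∨ᶠ_ _⇒ᶠ_ : Formula V n → Formula V n → Formula V n
  ∀ᶠ ∃ᶠ : Formula V (suc n) → Formula V n

infixr 6 _∧ᶠ_
infixr 5 _∨ᶠ_
infixr 4 _⇒ᶠ_
infix 7 ¬ᶠ_

Sentence : Vocabulary → Set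
Sentence V = Formula V 0

mutual
  renTerm : ∀ {V W n} → VocMor V W → Term V n → Term W n
  renTerm σ (var i) = var i
  renTerm σ (app f ts) = app (funMap σ f) (renTerms σ ts)

  renTerms : ∀ {V W n m} → VocMor V W → Vec (Term V n) m → Vec (Term W n) m
  renTerms σ [] = []
  renTerms σ (t ∷ ts) = renTerm σ t ∷ renTerms σ ts

renFormula : ∀ {V W n} → VocMor V W → Formula V n → Formula W n
renFormula σ ⊤ᶠ = ⊤ᶠ
renFormula σ ⊥ᶠ = ⊥ᶠ
renFormula σ (rel r ts) = rel (relMap σ r) (renTerms σ ts)
renFormula σ (t ≐ u) = renTerm σ t ≐ renTerm σ u
renFormula σ (¬ᶠ φ) = ¬ᶠ (renFormula σ φ)
renFormula σ (φ ∧ᶠ ψ) = renFormula σ φ ∧ᶠ renFormula σ ψ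
renFormula σ (φ ∨ᶠ ψ) = renFormula σ φ ∨ᶠ renFormula σ ψ
renFormula σ (φ ⇒ᶠ ψ) = renFormula σ φ ⇒ᶠ renFormula σ ψ
renFormula σ (∀ᶠ φ) = ∀ᶠ (renFormula σ φ)
renFormula σ (∃ᶠ φ) = ∃ᶠ (renFormula σ φ)

swap⊎ : ∀ {A : Set} → A ⊎ A → A ⊎ A
swap⊎ (inj₁ x) = inj₂ x
swap⊎ (inj₂ x) = inj₁ x

unprimed : ∀ {V n} → Formula V n → Formula (V ²) n
unprimed = renFormula record { funMap = inj₁ ; relMap = inj₁ }

_′ : ∀ {V n} → Formula V n → Formula (V ²) n
φ ′ = renFormula record { funMap = inj₂ ; relMap = inj₂ } φ

_⁻¹ : ∀ {V n} → Formula (V ²) n → Formula (V ²) n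
τ ⁻¹ = renFormula record { funMap = swap⊎ ; relMap = swap⊎ } τ

record Structure (V : Vocabulary) (D : Set) : Set₁ where
  field
    funI : ∀ {m} → Fun V m → Vec D m → D
    relI : ∀ {m} → Rel V m → Vec D m → Set
open Structure public

pairStr : ∀ {V D} → Structure V D → Structure V D → Structure (V ²) D
funI (pairStr s t) (inj₁ f) = funI s f
funI (pairStr s t) (inj₂ f) = funI t f
relI (pairStr s t) (inj₁ r) = relI s r
relI (pairStr s t) (inj₂ r) = relI t r

extend : ∀ {D : Set} {n} → (Fin n → D) → D → Fin (suc n) → D
extend ρ d zero = d
extend ρ d (suc i) = ρ i

mutual
  evalTerm : ∀ {V D n} → Structure V D → (Fin n → D) → Term V n → D
  evalTerm M ρ (var i) = ρ i
  evalTerm M ρ (app f ts) = funI M f (evalTerms M ρ ts)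

  evalTerms : ∀ {V D n m} → Structure V D → (Fin n → D) → Vec (Term V n) m → Vec D m
  evalTerms M ρ [] = []
  evalTerms M ρ (t ∷ ts) = evalTerm M ρ t ∷ evalTerms M ρ ts

sat : ∀ {V D n} → Structure V D → (Fin n → D) → Formula V n → Set
sat M ρ ⊤ᶠ = Unit
sat M ρ ⊥ᶠ = ⊥
sat M ρ (rel r ts) = relI M r (evalTerms M ρ ts)
sat M ρ (t ≐ u) = evalTerm M ρ t ≡ evalTerm M ρ u
sat M ρ (¬ᶠ φ) = ¬ sat M ρ φ
sat M ρ (φ ∧ᶠ ψ) = sat M ρ φ × sat M ρ ψ
sat M ρ (φ ∨ᶠ ψ) = sat M ρ φ ⊎ sat M ρ ψ
sat M ρ (φ ⇒ᶠ ψ) = sat M ρ φ → sat M ρ ψ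
sat {D = D} M ρ (∀ᶠ φ) = (d : D) → sat M (extend ρ d) φ
sat {D = D} M ρ (∃ᶠ φ) = Σ D (λ d → sat M (extend ρ d) φ)

emptyEnv : ∀ {D : Set} → Fin 0 → D
emptyEnv ()

infix 3 _⊨_
_⊨_ : ∀ {V D} → Structure V D → Sentence V → Set
M ⊨ φ = sat M emptyEnv φ

-- validity: truth in every structure over every (non-empty) domain
Valid : ∀ {V} → Sentence V → Set₁
Valid {V} φ = (D : Set) → D → (M : Structure V D) → M ⊨ φ

infix 2 _⇛_
_⇛_ : ∀ {V} → Sentence V → Sentence V → Set₁
A ⇛ B = Valid (A ⇒ᶠ B)

record SafetyProblem (V : Vocabulary) : Set where
  constructor ⟨_,_,_⟩
  field
    init  : Sentence V
    trans : Sentence (V ²)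
    bad   : Sentence V

record Trace (V : Vocabulary) (τ : Sentence (V ²)) : Set₁ where
  field
    Dom   : Set
    elem  : Dom
    len   : ℕ
    state : ℕ → Structure V Dom    -- only s₀ … s_k matter
    step  : ∀ i → i < len → pairStr (state i) (state (suc i)) ⊨ τ
open Trace public

Safe : ∀ {V} → SafetyProblem V → Set₁
Safe {V} ⟨ ι , τ , β ⟩ =
  (t : Trace V τ) → state t 0 ⊨ ι → state t (len t) ⊨ β → ⊥

data FBI {V : Vocabulary} : SafetyProblem V → Set₁ where
  Ind  : ∀ {ι τ φ} →
         ι ⇛ φ →
         (unprimed φ ∧ᶠ τ) ⇛ φ ′ →
         FBI ⟨ ι , τ , ¬ᶠ φ ⟩
  Cons : ∀ {ι τ β φ} →
         φ ⇛ ¬ᶠ β →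
         FBI ⟨ ι , τ , ¬ᶠ φ ⟩ →
         FBI ⟨ ι , τ , β ⟩
  Inc  : ∀ {ι τ β φ} →
         FBI ⟨ ι , τ , ¬ᶠ φ ⟩ →
         FBI ⟨ ι ∧ᶠ φ , τ ∧ᶠ (unprimed φ ∧ᶠ φ ′) , β ∧ᶠ φ ⟩ →
         FBI ⟨ ι , τ , β ⟩
  Rev  : ∀ {ι τ β} →
         FBI ⟨ β , τ ⁻¹ , ι ⟩ →
         FBI ⟨ ι , τ , β ⟩

-- Soundness is proved rule by rule along the derivation.  (Ind): an inductive
-- invariant holds along every trace, by induction on the position.  (Rev): a
-- trace read backwards is a trace of τ⁻¹ from β to ι.  (Inc): by the first
-- premise φ holds in every reachable state, since a reachable ¬φ-state would
-- end a prefix refuting it (the one classical step); so every trace of τ from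
-- ι is already a trace of the strengthened problem.
module Submission where

open import Defs
open import Level using (0ℓ)
open import Axiom.ExcludedMiddle using (ExcludedMiddle)
open import Axiom.DoubleNegationElimination using (DoubleNegationElimination; em⇒dne)
open import Data.Nat using (ℕ; zero; suc; _≤_; _<_; _∸_; z≤n; s≤s)
open import Data.Nat.Properties using (≤-refl; ≤-trans; n≤1+n; <-≤-trans; +-∸-assoc; ∸-monoʳ-<; n∸n≡0)
open import Data.Fin using (Fin)
open import Data.Vec using (Vec; []; _∷_)
open import Data.Product using (_,_)
open import Data.Sum using (inj₁; inj₂)
open import Data.Product.Function.NonDependent.Propositional using (_×-⇔_)
open import Data.Sum.Function.Propositional using (_⊎-⇔_)
open import Function.Bundles using (_⇔_; mk⇔; Equivalence)
open import Function.Construct.Identity using (⇔-id)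
open import Function.Related.TypeIsomorphisms using (→-cong-⇔; ¬-cong-⇔)
open import Relation.Binary.PropositionalEquality using (_≡_; refl; sym; trans; cong; cong₂; subst)

open Equivalence using (to; from)

record IsReduct {V W : Vocabulary} {D : Set}
                (σ : VocMor V W) (M : Structure W D) (N : Structure V D) : Set where
  field
    funI-reduct : ∀ {m} (f : Fun V m) xs → funI M (funMap σ f) xs ≡ funI N f xs
    relI-reduct : ∀ {m} (r : Rel V m) xs → relI M (relMap σ r) xs ⇔ relI N r xs

module _ {V W : Vocabulary} {D : Set} {σ : VocMor V W} {M : Structure W D} {N : Structure V D}
         (reduct : IsReduct σ M N) where

  open IsReduct reduct

  mutual
    evalTerm-renTerm : ∀ {n} (ρ : Fin n → D) (t : Term V n) →
                       evalTerm M ρ (renTerm σ t) ≡ evalTerm N ρ t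
    evalTerm-renTerm ρ (var i)    = refl
    evalTerm-renTerm ρ (app f ts) =
      trans (cong (funI M (funMap σ f)) (evalTerms-renTerms ρ ts)) (funI-reduct f _)

    evalTerms-renTerms : ∀ {n m} (ρ : Fin n → D) (ts : Vec (Term V n) m) →
                         evalTerms M ρ (renTerms σ ts) ≡ evalTerms N ρ ts
    evalTerms-renTerms ρ []       = refl
    evalTerms-renTerms ρ (t ∷ ts) = cong₂ _∷_ (evalTerm-renTerm ρ t) (evalTerms-renTerms ρ ts)

  sat-renFormula : ∀ {n} (ρ : Fin n → D) (φ : Formula V n) →
                   sat M ρ (renFormula σ φ) ⇔ sat N ρ φ
  sat-renFormula ρ ⊤ᶠ = ⇔-id _
  sat-renFormula ρ ⊥ᶠ = ⇔-id _
  sat-renFormula ρ (rel r ts) rewrite evalTerms-renTerms ρ ts = relI-reduct r _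
  sat-renFormula ρ (t ≐ u) rewrite evalTerm-renTerm ρ t | evalTerm-renTerm ρ u = ⇔-id _
  sat-renFormula ρ (¬ᶠ φ)   = ¬-cong-⇔ (sat-renFormula ρ φ)
  sat-renFormula ρ (φ ∧ᶠ ψ) = sat-renFormula ρ φ ×-⇔ sat-renFormula ρ ψ
  sat-renFormula ρ (φ ∨ᶠ ψ) = sat-renFormula ρ φ ⊎-⇔ sat-renFormula ρ ψ
  sat-renFormula ρ (φ ⇒ᶠ ψ) = →-cong-⇔ (sat-renFormula ρ φ) (sat-renFormula ρ ψ)
  sat-renFormula ρ (∀ᶠ φ) = mk⇔ (λ h d → to (sat-renFormula (extend ρ d) φ) (h d))
                                (λ h d → from (sat-renFormula (extend ρ d) φ) (h d))
  sat-renFormula ρ (∃ᶠ φ) = mk⇔ (λ (d , h) → d , to (sat-renFormula (extend ρ d) φ) h)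
                                (λ (d , h) → d , from (sat-renFormula (extend ρ d) φ) h)

module _ {V : Vocabulary} {D : Set} (s t : Structure V D) where

  sat-unprimed : (φ : Sentence V) → (pairStr s t ⊨ unprimed φ) ⇔ (s ⊨ φ)
  sat-unprimed = sat-renFormula record
    { funI-reduct = λ _ _ → refl ; relI-reduct = λ _ _ → ⇔-id _ } emptyEnv

  sat-′ : (φ : Sentence V) → (pairStr s t ⊨ φ ′) ⇔ (t ⊨ φ)
  sat-′ = sat-renFormula record
    { funI-reduct = λ _ _ → refl ; relI-reduct = λ _ _ → ⇔-id _ } emptyEnv

  sat-⁻¹ : (τ : Sentence (V ²)) → (pairStr s t ⊨ τ ⁻¹) ⇔ (pairStr t s ⊨ τ)
  sat-⁻¹ = sat-renFormula record
    { funI-reduct = λ { (inj₁ f) _ → refl ; (inj₂ f) _ → refl }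
    ; relI-reduct = λ { (inj₁ r) _ → ⇔-id _ ; (inj₂ r) _ → ⇔-id _ } } emptyEnv

module _ {V : Vocabulary} {τ : Sentence (V ²)} where

  prefix : (t : Trace V τ) (k : ℕ) → k ≤ len t → Trace V τ
  prefix t k k≤len = record
    { Dom = Dom t ; elem = elem t ; len = k ; state = state t
    ; step = λ i i<k → step t i (<-≤-trans i<k k≤len) }

  reverse : Trace V τ → Trace V (τ ⁻¹)
  reverse t = record
    { Dom = Dom t ; elem = elem t ; len = len t
    ; state = λ i → state t (len t ∸ i)
    ; step = λ i i<len → from (sat-⁻¹ _ _ τ) (step-backwards i i<len) }
    where
    step-backwards : ∀ i → i < len t → pairStr (state t (len t ∸ suc i)) (state t (len t ∸ i)) ⊨ τ
    step-backwards i i<len =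
      subst (λ j → pairStr (state t (len t ∸ suc i)) (state t j) ⊨ τ)
            (sym (+-∸-assoc 1 i<len))  -- suc len ∸ suc i reduces to len ∸ i
            (step t (len t ∸ suc i) (∸-monoʳ-< (s≤s z≤n) i<len))

  restrict : ∀ {φ} (t : Trace V τ) → (∀ {i} → i ≤ len t → state t i ⊨ φ) →
             Trace V (τ ∧ᶠ (unprimed φ ∧ᶠ φ ′))
  restrict {φ} t φ-along = record
    { Dom = Dom t ; elem = elem t ; len = len t ; state = state t
    ; step = λ i i<len → step t i i<len ,
        from (sat-unprimed _ _ φ) (φ-along (≤-trans (n≤1+n i) i<len)) ,
        from (sat-′ _ _ φ) (φ-along i<len) }

HoldsOnReachable : ∀ {V} → Sentence V → Sentence (V ²) → Sentence V → Set₁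
HoldsOnReachable {V} ι τ φ =
  (t : Trace V τ) → state t 0 ⊨ ι → ∀ {i} → i ≤ len t → state t i ⊨ φ

module _ {V : Vocabulary} {τ : Sentence (V ²)} where

  inductive⇒holdsOnReachable : (ι φ : Sentence V) → ι ⇛ φ → (unprimed φ ∧ᶠ τ) ⇛ φ ′ →
                               HoldsOnReachable ι τ φ
  inductive⇒holdsOnReachable ι φ initiation consecution t s₀⊨ι = go
    where
    go : ∀ {i} → i ≤ len t → state t i ⊨ φ
    go {zero}  _       = initiation (Dom t) (elem t) (state t 0) s₀⊨ι
    go {suc i} 1+i≤len = to (sat-′ (state t i) (state t (suc i)) φ)
      (consecution (Dom t) (elem t) (pairStr (state t i) (state t (suc i)))
        (from (sat-unprimed _ _ φ) (go (≤-trans (n≤1+n i) 1+i≤len)) , step t i 1+i≤len))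

  holdsOnReachable⇒safe : (ι φ : Sentence V) → HoldsOnReachable ι τ φ → Safe ⟨ ι , τ , ¬ᶠ φ ⟩
  holdsOnReachable⇒safe ι φ φ-reachable t s₀⊨ι sₖ⊨¬φ = sₖ⊨¬φ (φ-reachable t s₀⊨ι ≤-refl)

  safe⇒holdsOnReachable : DoubleNegationElimination 0ℓ →
                          (ι φ : Sentence V) → Safe ⟨ ι , τ , ¬ᶠ φ ⟩ → HoldsOnReachable ι τ φ
  safe⇒holdsOnReachable dne ι φ safe t s₀⊨ι {i} i≤len = dne (safe (prefix t i i≤len) s₀⊨ι)

  Ind-sound : (ι φ : Sentence V) → ι ⇛ φ → (unprimed φ ∧ᶠ τ) ⇛ φ ′ → Safe ⟨ ι , τ , ¬ᶠ φ ⟩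
  Ind-sound ι φ initiation consecution =
    holdsOnReachable⇒safe ι φ (inductive⇒holdsOnReachable ι φ initiation consecution)

  Cons-sound : (ι β φ : Sentence V) → φ ⇛ ¬ᶠ β → Safe ⟨ ι , τ , ¬ᶠ φ ⟩ → Safe ⟨ ι , τ , β ⟩
  Cons-sound ι β φ φ⇛¬β safe t s₀⊨ι sₖ⊨β =
    safe t s₀⊨ι (λ sₖ⊨φ → φ⇛¬β (Dom t) (elem t) (state t (len t)) sₖ⊨φ sₖ⊨β)

  Inc-sound : DoubleNegationElimination 0ℓ → (ι β φ : Sentence V) →
              Safe ⟨ ι , τ , ¬ᶠ φ ⟩ →
              Safe ⟨ ι ∧ᶠ φ , τ ∧ᶠ (unprimed φ ∧ᶠ φ ′) , β ∧ᶠ φ ⟩ →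
              Safe ⟨ ι , τ , β ⟩
  Inc-sound dne ι β φ safe-¬φ safe-restricted t s₀⊨ι sₖ⊨β =
    safe-restricted (restrict t φ-along) (s₀⊨ι , φ-along z≤n) (sₖ⊨β , φ-along ≤-refl)
    where
    φ-along : ∀ {i} → i ≤ len t → state t i ⊨ φ
    φ-along = safe⇒holdsOnReachable dne ι φ safe-¬φ t s₀⊨ι

  Rev-sound : (ι β : Sentence V) → Safe ⟨ β , τ ⁻¹ , ι ⟩ → Safe ⟨ ι , τ , β ⟩
  Rev-sound ι β safe t s₀⊨ι sₖ⊨β =
    safe (reverse t) sₖ⊨β (subst (λ j → state t j ⊨ ι) (sym (n∸n≡0 (len t))) s₀⊨ι)

theorem4p10 : ExcludedMiddle 0ℓ →
    {V : Vocabulary} (P : SafetyProblem V) → FBI P → Safe P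
theorem4p10 em _ (Ind {ι} {φ = φ} initiation consecution) = Ind-sound ι φ initiation consecution
theorem4p10 em _ (Cons {ι} {β = β} {φ} φ⇛¬β d) = Cons-sound ι β φ φ⇛¬β (theorem4p10 em _ d)
theorem4p10 em _ (Inc {ι} {β = β} {φ} d₁ d₂) =
  Inc-sound (em⇒dne em) ι β φ (theorem4p10 em _ d₁) (theorem4p10 em _ d₂)
theorem4p10 em _ (Rev {ι} {β = β} d) = Rev-sound ι β (theorem4p10 em _ d)
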